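{- For every projective plane $\Pi_q$ of order $q$ and every integer $3\le r\le q+1$, $$q(r-1)+1\le M_r(\Pi_q)\le (q+1)(r-1).$$
   Context: A finite projective plane $\Pi_q$ of order $q\ge 2$ has $q^2+q+1$ points and $q^2+q+1$ lines; every line contains $q+1$ points, every point lies on $q+1$ lines, any two lines meet in exactly one point and any two points lie on exactly one line. $r$-neighbor line percolation: for a set $A$ of points let $A^0=A$ and for $s\ge1$ let $A^s=A^{s-1}\cup\{P: \exists \text{ line } l\ni P \text{ with } |l\cap A^{s-1}|\ge r\}$; $A$ percolates if $A^k$ equals the whole point set for some $k$. $M_r(\Pi_q)$ is the maximum size of a set of points that does not percolate. -}

module Defs where

open import Data.Nat using (ℕ; zero; suc; _+_; _*_; _≤_; _≤ᵇ_)
open import Data.Bool using (Bool; true; false; _∧_; _∨_)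
open import Data.Fin using (Fin)
open import Data.Fin.Subset using (Subset; ∣_∣; _∩_; _∪_; ⊤)
open import Data.Vec using (Vec; tabulate; lookup; foldr′)
open import Data.Product using (∃; _×_)
open import Relation.Binary.PropositionalEquality using (_≡_; _≢_)
open import Function using (_∘_)

record ProjectivePlane (q : ℕ) : Set where
  field
    line : Fin (q * q + q + 1) → Subset (q * q + q + 1)

  on : Fin (q * q + q + 1) → Fin (q * q + q + 1) → Bool
  on P l = lookup (line l) P

  field
    line-size  : ∀ l → ∣ line l ∣ ≡ suc q
    point-deg  : ∀ P → ∣ tabulate (on P) ∣ ≡ suc q
    lines-meet : ∀ l m → l ≢ m → ∣ line l ∩ line m ∣ ≡ 1
    points-join : ∀ P Q → P ≢ Q → ∣ tabulate (λ l → on P l ∧ on Q l) ∣ ≡ 1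

module _ {q : ℕ} (Π : ProjectivePlane q) (r : ℕ) where
  open ProjectivePlane Π

  private
    N = q * q + q + 1

  anyᵇ : ∀ {n} → Vec Bool n → Bool
  anyᵇ = foldr′ _∨_ false

  step : Subset N → Subset N
  step A = A ∪ tabulate (λ P → anyᵇ (tabulate (λ l → on P l ∧ (r ≤ᵇ ∣ line l ∩ A ∣))))

  iterate : ℕ → Subset N → Subset N
  iterate zero    A = A
  iterate (suc k) A = step (iterate k A)

  Percolates : Subset N → Set
  Percolates A = ∃ λ k → iterate k A ≡ ⊤

  -- "x ≤ M_r(Π)": some non-percolating set has at least x points
  -- (M_r is the maximum size of a non-percolating set)
  LowerBoundM : ℕ → Set
  LowerBoundM x = ∃ λ A → (Percolates A → Data.Empty.⊥) × x ≤ ∣ A ∣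
    where import Data.Empty

  -- "M_r(Π) ≤ x": every non-percolating set has at most x points
  UpperBoundM : ℕ → Set
  UpperBoundM x = ∀ A → (Percolates A → Data.Empty.⊥) → ∣ A ∣ ≤ x
    where import Data.Empty

-- Upper bound: a non-percolating set A lies in a proper closed set S (the
-- limit of the process started at A).  Pick a point P ∉ S: each of the q + 1
-- lines through P carries at most r − 1 points of S, and these lines cover S
-- exactly once, so |S| ≤ (q + 1)(r − 1).
-- Lower bound: the union of r − 1 lines through a common point has
-- q(r − 1) + 1 points and is closed, since every other line meets it in at
-- most r − 1 points; it is proper because (q + 1)(r − 1) < q² + q + 1.
module Submission where

open import Defs
open import Data.Nat using (ℕ; zero; suc; _+_; _*_; _∸_; _≤_; _<_; z≤n; s≤s; z<s; _≤ᵇ_)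
open import Data.Nat.Properties hiding (suc-injective)
open import Algebra.Properties.CommutativeMonoid.Sum +-0-commutativeMonoid
  using (sum; sum-cong-≗; ∑-comm)
open import Algebra.Properties.CommutativeSemigroup *-commutativeSemigroup
  using (x∙yz≈y∙xz)
open import Algebra.Properties.Semiring.Sum +-*-semiring
  using (*-distribˡ-sum; *-distribʳ-sum)
open import Data.Bool using (Bool; true; false; _∧_; _∨_)
open import Data.Bool.Properties using (∧-conicalˡ; ∧-conicalʳ; ∨-zeroʳ; T-≡)
open import Data.Empty using (⊥-elim)
open import Data.Fin using (Fin; zero; suc)
open import Data.Fin.Properties using (suc-injective; ¬∀⟶∃¬)
open import Data.Fin.Subset
  using (Subset; ∣_∣; _∩_; ⊤; ⊥; _∈_; _∉_; _⊆_; Nonempty; inside; outside)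
open import Data.Fin.Subset.Properties
  using ( _∈?_; _⊂?_; ⊆-antisym; ⊆⊤; ⊥⊆; ∣⊥∣≡0; ∣⊤∣≡n; ∣p∣≤n; s⊆s; out⊆
        ; p⊆q⇒∣p∣≤∣q∣; p⊂q⇒∣p∣<∣q∣; p⊆p∪q; x∈p∪q⁺; x∈p∪q⁻; x∈p∩q⁺; x∈p∩q⁻
        ; ∣p∩q∣≤∣p∣)
open import Data.Product using (_×_; ∃; _,_)
open import Data.Sum using (_⊎_; inj₁; inj₂)
open import Data.Vec using ([]; _∷_; lookup; tabulate; foldr′; here; there)
open import Data.Vec.Functional using (Vector)
open import Data.Vec.Properties using (lookup-zipWith; lookup∘tabulate; []=⇒lookup; lookup⇒[]=)
open import Function using (_∘_; _$_; Equivalence)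
open import Relation.Nullary using (¬_; yes; no)
open import Relation.Binary.PropositionalEquality

𝟙 : Bool → ℕ
𝟙 true  = 1
𝟙 false = 0

𝟙-∧ : ∀ a b → 𝟙 (a ∧ b) ≡ 𝟙 a * 𝟙 b
𝟙-∧ true  b = sym (+-identityʳ (𝟙 b))
𝟙-∧ false b = refl

sum-mono-≤ : ∀ {n} {f g : Vector ℕ n} → (∀ i → f i ≤ g i) → sum f ≤ sum g
sum-mono-≤ {zero}  _   = z≤n
sum-mono-≤ {suc n} f≤g = +-mono-≤ (f≤g zero) (sum-mono-≤ (f≤g ∘ suc))

sum-mono-except : ∀ {n} {f g : Vector ℕ n} (i : Fin n) → (∀ j → j ≢ i → f j ≤ g j) →
                  sum f + g i ≤ sum g + f i
sum-mono-except {suc n} {f} {g} zero f≤g = begin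
  f zero + sum (f ∘ suc) + g zero
    ≡⟨ +-comm (f zero + _) (g zero) ⟩
  g zero + (f zero + sum (f ∘ suc))
    ≡⟨ cong (g zero +_) (+-comm (f zero) _) ⟩
  g zero + (sum (f ∘ suc) + f zero)
    ≡⟨ sym (+-assoc (g zero) _ (f zero)) ⟩
  g zero + sum (f ∘ suc) + f zero
    ≤⟨ +-monoˡ-≤ (f zero) (+-monoʳ-≤ (g zero) rest) ⟩
  g zero + sum (g ∘ suc) + f zero ∎
  where
  open ≤-Reasoning
  rest : sum (f ∘ suc) ≤ sum (g ∘ suc)
  rest = sum-mono-≤ (λ j → f≤g (suc j) (λ ()))
sum-mono-except {suc n} {f} {g} (suc i) f≤g = begin
  f zero + sum (f ∘ suc) + g (suc i)
    ≡⟨ +-assoc (f zero) _ _ ⟩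
  f zero + (sum (f ∘ suc) + g (suc i))
    ≤⟨ +-mono-≤ (f≤g zero (λ ())) rest ⟩
  g zero + (sum (g ∘ suc) + f (suc i))
    ≡⟨ sym (+-assoc (g zero) _ _) ⟩
  g zero + sum (g ∘ suc) + f (suc i) ∎
  where
  open ≤-Reasoning
  rest : sum (f ∘ suc) + g (suc i) ≤ sum (g ∘ suc) + f (suc i)
  rest = sum-mono-except i (λ j j≢i → f≤g (suc j) (j≢i ∘ suc-injective))

∑-swap-weighted : ∀ {m n} (a : Vector ℕ m) (b : Vector ℕ n) (c : Fin m → Fin n → ℕ) →
                  sum (λ i → a i * sum (λ j → b j * c i j)) ≡
                  sum (λ j → b j * sum (λ i → a i * c i j))
∑-swap-weighted a b c = begin
  sum (λ i → a i * sum (λ j → b j * c i j))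
    ≡⟨ sum-cong-≗ (λ i → *-distribˡ-sum (a i) (λ j → b j * c i j)) ⟩
  sum (λ i → sum (λ j → a i * (b j * c i j)))
    ≡⟨ sum-cong-≗ (λ i → sum-cong-≗ (λ j → x∙yz≈y∙xz (a i) (b j) (c i j))) ⟩
  sum (λ i → sum (λ j → b j * (a i * c i j)))
    ≡⟨ ∑-comm (λ i j → b j * (a i * c i j)) ⟩
  sum (λ j → sum (λ i → b j * (a i * c i j)))
    ≡⟨ sum-cong-≗ (λ j → sym (*-distribˡ-sum (b j) (λ i → a i * c i j))) ⟩
  sum (λ j → b j * sum (λ i → a i * c i j)) ∎
  where open ≡-Reasoning

∣p∣≡∑𝟙 : ∀ {n} (p : Subset n) → ∣ p ∣ ≡ sum (𝟙 ∘ lookup p)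
∣p∣≡∑𝟙 []          = refl
∣p∣≡∑𝟙 (true ∷ p)  = cong suc (∣p∣≡∑𝟙 p)
∣p∣≡∑𝟙 (false ∷ p) = ∣p∣≡∑𝟙 p

∣tabulate∣≡∑𝟙 : ∀ {n} (f : Fin n → Bool) → ∣ tabulate f ∣ ≡ sum (𝟙 ∘ f)
∣tabulate∣≡∑𝟙 f = trans (∣p∣≡∑𝟙 (tabulate f)) (sum-cong-≗ (cong 𝟙 ∘ lookup∘tabulate f))

∣p∩q∣≡∑𝟙*𝟙 : ∀ {n} (p q : Subset n) →
              ∣ p ∩ q ∣ ≡ sum (λ i → 𝟙 (lookup p i) * 𝟙 (lookup q i))
∣p∩q∣≡∑𝟙*𝟙 p q = trans (∣p∣≡∑𝟙 (p ∩ q)) (sum-cong-≗ 𝟙-lookup-∩)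
  where
  𝟙-lookup-∩ : ∀ i → 𝟙 (lookup (p ∩ q) i) ≡ 𝟙 (lookup p i) * 𝟙 (lookup q i)
  𝟙-lookup-∩ i = trans (cong 𝟙 (lookup-zipWith _∧_ i p q)) (𝟙-∧ (lookup p i) (lookup q i))

∈tabulate⁻ : ∀ {n} {f : Fin n → Bool} {x} → x ∈ tabulate f → f x ≡ true
∈tabulate⁻ {f = f} {x} x∈ = trans (sym (lookup∘tabulate f x)) ([]=⇒lookup x∈)

∈tabulate⁺ : ∀ {n} {f : Fin n → Bool} {x} → f x ≡ true → x ∈ tabulate f
∈tabulate⁺ {f = f} {x} fx = lookup⇒[]= x (tabulate f) (trans (lookup∘tabulate f x) fx)

∩-monoˡ-⊆ : ∀ {n} {p p′ : Subset n} (q : Subset n) → p ⊆ p′ → p ∩ q ⊆ p′ ∩ q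
∩-monoˡ-⊆ {p = p} q p⊆p′ x∈p∩q with x∈p∩q⁻ p q x∈p∩q
... | x∈p , x∈q = x∈p∩q⁺ (p⊆p′ x∈p , x∈q)

p≢⊤⇒∃∉ : ∀ {n} {p : Subset n} → p ≢ ⊤ → ∃ λ x → x ∉ p
p≢⊤⇒∃∉ {n} {p} p≢⊤ =
  ¬∀⟶∃¬ n (_∈ p) (_∈? p) (λ all∈p → p≢⊤ (⊆-antisym ⊆⊤ (λ {x} _ → all∈p x)))

subset-of-size : ∀ {n} (p : Subset n) k → k ≤ ∣ p ∣ → ∃ λ s → s ⊆ p × ∣ s ∣ ≡ k
subset-of-size {n} p zero _ = ⊥ , ⊥⊆ , ∣⊥∣≡0 n
subset-of-size (inside ∷ p) (suc k) (s≤s k≤∣p∣) with subset-of-size p k k≤∣p∣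
... | s , s⊆p , ∣s∣≡k = inside ∷ s , s⊆s s⊆p , cong suc ∣s∣≡k
subset-of-size (outside ∷ p) (suc k) k<∣p∣ with subset-of-size p (suc k) k<∣p∣
... | s , s⊆p , ∣s∣≡k = outside ∷ s , out⊆ s⊆p , ∣s∣≡k

⊆-chain-stabilises : ∀ {n} (S : ℕ → Subset n) → (∀ k → S k ⊆ S (suc k)) →
                     ∃ λ k → S (suc k) ≡ S k
⊆-chain-stabilises {n} S S⊆S with stabilises-or-grows (suc n)
  where
  stabilises-or-grows : ∀ k → (∃ λ j → S (suc j) ≡ S j) ⊎ k ≤ ∣ S k ∣
  stabilises-or-grows zero = inj₂ z≤n
  stabilises-or-grows (suc k) with stabilises-or-grows k | S k ⊂? S (suc k)
  ... | inj₁ stable | _        = inj₁ stable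
  ... | inj₂ k≤∣S∣  | yes S⊂S′ = inj₂ (≤-<-trans k≤∣S∣ (p⊂q⇒∣p∣<∣q∣ S⊂S′))
  ... | inj₂ _      | no S⊄S′  = inj₁ (k , ⊆-antisym shrinks (S⊆S k))
    where
    shrinks : S (suc k) ⊆ S k
    shrinks {x} x∈S′ with x ∈? S k
    ... | yes x∈S = x∈S
    ... | no  x∉S = ⊥-elim (S⊄S′ (S⊆S k , x , x∈S′ , x∉S))
... | inj₁ stable  = stable
... | inj₂ n<∣S∣   = ⊥-elim (<⇒≱ n<∣S∣ (∣p∣≤n (S (suc n))))

∨-foldr≡true⇒Nonempty : ∀ {n} (p : Subset n) → foldr′ _∨_ false p ≡ true → Nonempty p
∨-foldr≡true⇒Nonempty (true ∷ p)  _  = zero , here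
∨-foldr≡true⇒Nonempty (false ∷ p) eq with ∨-foldr≡true⇒Nonempty p eq
... | x , x∈p = suc x , there x∈p

∈⇒∨-foldr≡true : ∀ {n} {p : Subset n} {x} → x ∈ p → foldr′ _∨_ false p ≡ true
∈⇒∨-foldr≡true here                  = refl
∈⇒∨-foldr≡true {p = b ∷ p} (there x∈p) =
  trans (cong (b ∨_) (∈⇒∨-foldr≡true x∈p)) (∨-zeroʳ b)

0<∣p∣⇒∨-foldr≡true : ∀ {n} (p : Subset n) → 0 < ∣ p ∣ → foldr′ _∨_ false p ≡ true
0<∣p∣⇒∨-foldr≡true (true ∷ p)  _     = refl
0<∣p∣⇒∨-foldr≡true (false ∷ p) 0<∣p∣ = 0<∣p∣⇒∨-foldr≡true p 0<∣p∣

𝟙[∨-foldr]≤∣p∣ : ∀ {n} (p : Subset n) → 𝟙 (foldr′ _∨_ false p) ≤ ∣ p ∣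
𝟙[∨-foldr]≤∣p∣ []          = z≤n
𝟙[∨-foldr]≤∣p∣ (true ∷ p)  = s≤s z≤n
𝟙[∨-foldr]≤∣p∣ (false ∷ p) = 𝟙[∨-foldr]≤∣p∣ p

∣p∣≤1⇒∣p∣≤𝟙[∨-foldr] : ∀ {n} (p : Subset n) → ∣ p ∣ ≤ 1 →
                        ∣ p ∣ ≤ 𝟙 (foldr′ _∨_ false p)
∣p∣≤1⇒∣p∣≤𝟙[∨-foldr] p ∣p∣≤1 with ∣ p ∣ ≟ 0
... | yes ∣p∣≡0 = ≤-trans (≤-reflexive ∣p∣≡0) z≤n
... | no  ∣p∣≢0 rewrite 0<∣p∣⇒∨-foldr≡true p (n≢0⇒n>0 ∣p∣≢0) = ∣p∣≤1

module _ {q : ℕ} (Π : ProjectivePlane q) where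
  open ProjectivePlane Π

  private
    N : ℕ
    N = q * q + q + 1

  N≡suc[suc-q*q] : N ≡ suc (suc q * q)
  N≡suc[suc-q*q] = trans (+-comm (q * q + q) 1) (cong suc (+-comm (q * q) q))

  P₀ : Fin N
  P₀ = subst Fin (sym N≡suc[suc-q*q]) zero

  pencil : Fin N → Subset N
  pencil P = tabulate (on P)

  lookup-pencil : ∀ P l → lookup (pencil P) l ≡ on P l
  lookup-pencil P = lookup∘tabulate (on P)

  ∈line⇒∈pencil : ∀ {P l} → P ∈ line l → l ∈ pencil P
  ∈line⇒∈pencil P∈l = ∈tabulate⁺ ([]=⇒lookup P∈l)

  ∑𝟙[on]≡suc-q : ∀ P → sum (λ l → 𝟙 (on P l)) ≡ suc q
  ∑𝟙[on]≡suc-q P = trans (sym (∣tabulate∣≡∑𝟙 (on P))) (point-deg P)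

  ∑𝟙[on-P]*𝟙[on-Q]≡1 : ∀ {P Q} → P ≢ Q → sum (λ l → 𝟙 (on P l) * 𝟙 (on Q l)) ≡ 1
  ∑𝟙[on-P]*𝟙[on-Q]≡1 {P} {Q} P≢Q = begin
    sum (λ l → 𝟙 (on P l) * 𝟙 (on Q l))
      ≡⟨ sum-cong-≗ (λ l → sym (𝟙-∧ (on P l) (on Q l))) ⟩
    sum (λ l → 𝟙 (on P l ∧ on Q l))
      ≡⟨ sym (∣tabulate∣≡∑𝟙 (λ l → on P l ∧ on Q l)) ⟩
    ∣ tabulate (λ l → on P l ∧ on Q l) ∣
      ≡⟨ points-join P Q P≢Q ⟩
    1 ∎
    where open ≡-Reasoning

  ∣L∩pencil∣≡∑ : ∀ (L : Subset N) Q →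
                 ∣ L ∩ pencil Q ∣ ≡ sum (λ m → 𝟙 (lookup L m) * 𝟙 (on Q m))
  ∣L∩pencil∣≡∑ L Q = trans (∣p∩q∣≡∑𝟙*𝟙 L (pencil Q))
    (sum-cong-≗ (λ m → cong (λ b → 𝟙 (lookup L m) * 𝟙 b) (lookup-pencil Q m)))

  ∣pencil∩pencil∣≡1 : ∀ {P Q} → P ≢ Q → ∣ pencil P ∩ pencil Q ∣ ≡ 1
  ∣pencil∩pencil∣≡1 {P} {Q} P≢Q = begin
    ∣ pencil P ∩ pencil Q ∣
      ≡⟨ ∣L∩pencil∣≡∑ (pencil P) Q ⟩
    sum (λ l → 𝟙 (lookup (pencil P) l) * 𝟙 (on Q l))
      ≡⟨ sum-cong-≗ (λ l → cong (λ a → 𝟙 a * 𝟙 (on Q l)) (lookup-pencil P l)) ⟩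
    sum (λ l → 𝟙 (on P l) * 𝟙 (on Q l))
      ≡⟨ ∑𝟙[on-P]*𝟙[on-Q]≡1 P≢Q ⟩
    1 ∎
    where open ≡-Reasoning

  ∣S∣≡∑-over-pencil : ∀ {S P} → P ∉ S → ∣ S ∣ ≡ sum (λ l → 𝟙 (on P l) * ∣ line l ∩ S ∣)
  ∣S∣≡∑-over-pencil {S} {P} P∉S = begin
    ∣ S ∣
      ≡⟨ ∣p∣≡∑𝟙 S ⟩
    sum (λ Q → 𝟙 (lookup S Q))
      ≡⟨ sum-cong-≗ one-joining-line ⟩
    sum (λ Q → 𝟙 (lookup S Q) * sum (λ l → 𝟙 (on P l) * 𝟙 (on Q l)))
      ≡⟨ ∑-swap-weighted (λ Q → 𝟙 (lookup S Q)) (λ l → 𝟙 (on P l)) (λ Q l → 𝟙 (on Q l)) ⟩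
    sum (λ l → 𝟙 (on P l) * sum (λ Q → 𝟙 (lookup S Q) * 𝟙 (on Q l)))
      ≡⟨ sum-cong-≗ (λ l → cong (𝟙 (on P l) *_) (line∩S l)) ⟩
    sum (λ l → 𝟙 (on P l) * ∣ line l ∩ S ∣) ∎
    where
    open ≡-Reasoning
    one-joining-line : ∀ Q →
                       𝟙 (lookup S Q) ≡ 𝟙 (lookup S Q) * sum (λ l → 𝟙 (on P l) * 𝟙 (on Q l))
    one-joining-line Q with lookup S Q in Q∈S
    ... | false = refl
    ... | true  = sym (trans (+-identityʳ _) (∑𝟙[on-P]*𝟙[on-Q]≡1 P≢Q))
      where
      P≢Q : P ≢ Q
      P≢Q refl = P∉S (lookup⇒[]= P S Q∈S)
    line∩S : ∀ l → sum (λ Q → 𝟙 (lookup S Q) * 𝟙 (on Q l)) ≡ ∣ line l ∩ S ∣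
    line∩S l =
      trans (sum-cong-≗ (λ Q → *-comm (𝟙 (lookup S Q)) _)) (sym (∣p∩q∣≡∑𝟙*𝟙 (line l) S))

  -- L is a set of lines, i.e. of indices of `line`; ⋃ L is the set of points on them.
  ⋃ : Subset N → Subset N
  ⋃ L = tabulate (λ Q → foldr′ _∨_ false (L ∩ pencil Q))

  lookup-⋃ : ∀ L Q → lookup (⋃ L) Q ≡ foldr′ _∨_ false (L ∩ pencil Q)
  lookup-⋃ L = lookup∘tabulate (λ Q → foldr′ _∨_ false (L ∩ pencil Q))

  ∈⋃⁺ : ∀ {L m Q} → m ∈ L → Q ∈ line m → Q ∈ ⋃ L
  ∈⋃⁺ {L} m∈L Q∈m = ∈tabulate⁺ {f = λ X → foldr′ _∨_ false (L ∩ pencil X)}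
    (∈⇒∨-foldr≡true (x∈p∩q⁺ (m∈L , ∈line⇒∈pencil Q∈m)))

  𝟙[⋃]≤∣L∩pencil∣ : ∀ L Q → 𝟙 (lookup (⋃ L) Q) ≤ ∣ L ∩ pencil Q ∣
  𝟙[⋃]≤∣L∩pencil∣ L Q rewrite lookup-⋃ L Q = 𝟙[∨-foldr]≤∣p∣ (L ∩ pencil Q)

  ∑∣L∩pencil∣≡suc-q*∣L∣ : ∀ L → sum (λ Q → ∣ L ∩ pencil Q ∣) ≡ suc q * ∣ L ∣
  ∑∣L∩pencil∣≡suc-q*∣L∣ L = begin
    sum (λ Q → ∣ L ∩ pencil Q ∣)
      ≡⟨ sum-cong-≗ (∣L∩pencil∣≡∑ L) ⟩
    sum (λ Q → sum (λ m → 𝟙 (lookup L m) * 𝟙 (on Q m)))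
      ≡⟨ ∑-comm (λ Q m → 𝟙 (lookup L m) * 𝟙 (on Q m)) ⟩
    sum (λ m → sum (λ Q → 𝟙 (lookup L m) * 𝟙 (on Q m)))
      ≡⟨ sum-cong-≗ (λ m → sym (*-distribˡ-sum (𝟙 (lookup L m)) (λ Q → 𝟙 (on Q m)))) ⟩
    sum (λ m → 𝟙 (lookup L m) * sum (λ Q → 𝟙 (on Q m)))
      ≡⟨ sum-cong-≗ (λ m → cong (𝟙 (lookup L m) *_) (points-on m)) ⟩
    sum (λ m → 𝟙 (lookup L m) * suc q)
      ≡⟨ sym (*-distribʳ-sum (suc q) (λ m → 𝟙 (lookup L m))) ⟩
    sum (λ m → 𝟙 (lookup L m)) * suc q
      ≡⟨ cong (_* suc q) (sym (∣p∣≡∑𝟙 L)) ⟩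
    ∣ L ∣ * suc q
      ≡⟨ *-comm ∣ L ∣ (suc q) ⟩
    suc q * ∣ L ∣ ∎
    where
    open ≡-Reasoning
    points-on : ∀ m → sum (λ Q → 𝟙 (on Q m)) ≡ suc q
    points-on m = trans (sym (∣p∣≡∑𝟙 (line m))) (line-size m)

  ∣⋃∣≤suc-q*∣L∣ : ∀ L → ∣ ⋃ L ∣ ≤ suc q * ∣ L ∣
  ∣⋃∣≤suc-q*∣L∣ L = begin
    ∣ ⋃ L ∣
      ≡⟨ ∣p∣≡∑𝟙 (⋃ L) ⟩
    sum (λ Q → 𝟙 (lookup (⋃ L) Q))
      ≤⟨ sum-mono-≤ (𝟙[⋃]≤∣L∩pencil∣ L) ⟩
    sum (λ Q → ∣ L ∩ pencil Q ∣)
      ≡⟨ ∑∣L∩pencil∣≡suc-q*∣L∣ L ⟩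
    suc q * ∣ L ∣ ∎
    where open ≤-Reasoning

  ⋃≢⊤ : ∀ {L} → ∣ L ∣ ≤ q → ⋃ L ≢ ⊤
  ⋃≢⊤ {L} ∣L∣≤q ⋃L≡⊤ = <⇒≱ (≤-reflexive (sym N≡suc[suc-q*q])) N≤suc-q*q
    where
    N≤suc-q*q : N ≤ suc q * q
    N≤suc-q*q = begin
      N
        ≡⟨ sym (∣⊤∣≡n N) ⟩
      ∣ ⊤ {N} ∣
        ≡⟨ cong ∣_∣ (sym ⋃L≡⊤) ⟩
      ∣ ⋃ L ∣
        ≤⟨ ∣⋃∣≤suc-q*∣L∣ L ⟩
      suc q * ∣ L ∣
        ≤⟨ *-monoʳ-≤ (suc q) ∣L∣≤q ⟩
      suc q * q ∎
      where open ≤-Reasoning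

  ∣line∩⋃∣≤∣L∣ : ∀ {L l} → l ∉ L → ∣ line l ∩ ⋃ L ∣ ≤ ∣ L ∣
  ∣line∩⋃∣≤∣L∣ {L} {l} l∉L = begin
    ∣ line l ∩ ⋃ L ∣
      ≡⟨ ∣p∩q∣≡∑𝟙*𝟙 (line l) (⋃ L) ⟩
    sum (λ Q → 𝟙 (on Q l) * 𝟙 (lookup (⋃ L) Q))
      ≤⟨ sum-mono-≤ (λ Q → *-monoʳ-≤ (𝟙 (on Q l)) (𝟙[⋃]≤∣L∩pencil∣ L Q)) ⟩
    sum (λ Q → 𝟙 (on Q l) * ∣ L ∩ pencil Q ∣)
      ≡⟨ sum-cong-≗ (λ Q → cong (𝟙 (on Q l) *_) (∣L∩pencil∣≡∑ L Q)) ⟩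
    sum (λ Q → 𝟙 (on Q l) * sum (λ m → 𝟙 (lookup L m) * 𝟙 (on Q m)))
      ≡⟨ ∑-swap-weighted (λ Q → 𝟙 (on Q l)) (λ m → 𝟙 (lookup L m)) (λ Q m → 𝟙 (on Q m)) ⟩
    sum (λ m → 𝟙 (lookup L m) * sum (λ Q → 𝟙 (on Q l) * 𝟙 (on Q m)))
      ≡⟨ sum-cong-≗ meets-once ⟩
    sum (λ m → 𝟙 (lookup L m))
      ≡⟨ sym (∣p∣≡∑𝟙 L) ⟩
    ∣ L ∣ ∎
    where
    open ≤-Reasoning
    meets-once : ∀ m → 𝟙 (lookup L m) * sum (λ Q → 𝟙 (on Q l) * 𝟙 (on Q m)) ≡ 𝟙 (lookup L m)
    meets-once m with lookup L m in m∈L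
    ... | false = refl
    ... | true  =
      trans (+-identityʳ _) (trans (sym (∣p∩q∣≡∑𝟙*𝟙 (line l) (line m))) (lines-meet l m l≢m))
      where
      l≢m : l ≢ m
      l≢m refl = l∉L (lookup⇒[]= l L m∈L)

  q*∣L∣+1≤∣⋃∣ : ∀ {L P} → L ⊆ pencil P → 0 < ∣ L ∣ → q * ∣ L ∣ + 1 ≤ ∣ ⋃ L ∣
  q*∣L∣+1≤∣⋃∣ {L} {P} L⊆pencil 0<∣L∣ = +-cancelˡ-≤ ∣ L ∣ _ _ $ begin
    ∣ L ∣ + (q * ∣ L ∣ + 1)
      ≡⟨ sym (+-assoc ∣ L ∣ _ 1) ⟩
    suc q * ∣ L ∣ + 1
      ≡⟨ cong₂ _+_ (sym (∑∣L∩pencil∣≡suc-q*∣L∣ L)) (sym P∈⋃L) ⟩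
    sum (λ Q → ∣ L ∩ pencil Q ∣) + 𝟙 (lookup (⋃ L) P)
      ≤⟨ sum-mono-except P ∣L∩pencil∣≤𝟙[⋃] ⟩
    sum (λ Q → 𝟙 (lookup (⋃ L) Q)) + ∣ L ∩ pencil P ∣
      ≤⟨ +-mono-≤ (≤-reflexive (sym (∣p∣≡∑𝟙 (⋃ L)))) (∣p∩q∣≤∣p∣ L (pencil P)) ⟩
    ∣ ⋃ L ∣ + ∣ L ∣
      ≡⟨ +-comm ∣ ⋃ L ∣ ∣ L ∣ ⟩
    ∣ L ∣ + ∣ ⋃ L ∣ ∎
    where
    open ≤-Reasoning
    P∈⋃L : 𝟙 (lookup (⋃ L) P) ≡ 1
    P∈⋃L rewrite lookup-⋃ L P = cong 𝟙 (0<∣p∣⇒∨-foldr≡true (L ∩ pencil P)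
      (<-≤-trans 0<∣L∣ (p⊆q⇒∣p∣≤∣q∣ (λ m∈L → x∈p∩q⁺ (m∈L , L⊆pencil m∈L)))))
    ∣L∩pencil∣≤𝟙[⋃] : ∀ Q → Q ≢ P → ∣ L ∩ pencil Q ∣ ≤ 𝟙 (lookup (⋃ L) Q)
    ∣L∩pencil∣≤𝟙[⋃] Q Q≢P rewrite lookup-⋃ L Q = ∣p∣≤1⇒∣p∣≤𝟙[∨-foldr] (L ∩ pencil Q) $
      ≤-trans (p⊆q⇒∣p∣≤∣q∣ (∩-monoˡ-⊆ (pencil Q) L⊆pencil))
              (≤-reflexive (∣pencil∩pencil∣≡1 (Q≢P ∘ sym)))

  module _ (r : ℕ) where

    Closed : Subset N → Set
    Closed A = ∀ {P l} → P ∈ line l → r ≤ ∣ line l ∩ A ∣ → P ∈ A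

    ∈step⁺ : ∀ {A P l} → P ∈ line l → r ≤ ∣ line l ∩ A ∣ → P ∈ step Π r A
    ∈step⁺ {A} {P} {l} P∈l r≤∣l∩A∣ =
      x∈p∪q⁺ {p = A} (inj₂ (∈tabulate⁺ {f = reached}
        (∈⇒∨-foldr≡true (∈tabulate⁺ {f = rich P} l-rich))))
      where
      rich : Fin N → Fin N → Bool
      rich X m = on X m ∧ (r ≤ᵇ ∣ line m ∩ A ∣)
      reached : Fin N → Bool
      reached X = foldr′ _∨_ false (tabulate (rich X))
      l-rich : rich P l ≡ true
      l-rich = cong₂ _∧_ ([]=⇒lookup P∈l) (Equivalence.to T-≡ (≤⇒≤ᵇ r≤∣l∩A∣))

    ∈step⁻ : ∀ {A P} → P ∈ step Π r A →
             P ∈ A ⊎ ∃ λ l → P ∈ line l × r ≤ ∣ line l ∩ A ∣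
    ∈step⁻ {A} {P} P∈stepA with x∈p∪q⁻ A _ P∈stepA
    ... | inj₁ P∈A      = inj₁ P∈A
    ... | inj₂ P∈reached with ∨-foldr≡true⇒Nonempty _ (∈tabulate⁻ P∈reached)
    ...   | l , l∈ = inj₂ (l , lookup⇒[]= P (line l) (∧-conicalˡ _ _ l-rich) ,
                            ≤ᵇ⇒≤ r _ (Equivalence.from T-≡ (∧-conicalʳ _ _ l-rich)))
      where
      l-rich : on P l ∧ (r ≤ᵇ ∣ line l ∩ A ∣) ≡ true
      l-rich = ∈tabulate⁻ l∈

    closed⇒step≡ : ∀ {A} → Closed A → step Π r A ≡ A
    closed⇒step≡ {A} A-closed = ⊆-antisym step⊆A (p⊆p∪q _)
      where
      step⊆A : step Π r A ⊆ A
      step⊆A P∈stepA with ∈step⁻ P∈stepA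
      ... | inj₁ P∈A                = P∈A
      ... | inj₂ (l , P∈l , r≤∣l∩A∣) = A-closed P∈l r≤∣l∩A∣

    step≡⇒closed : ∀ {A} → step Π r A ≡ A → Closed A
    step≡⇒closed step≡A P∈l r≤∣l∩A∣ = subst (_ ∈_) step≡A (∈step⁺ P∈l r≤∣l∩A∣)

    closed⇒¬percolates : ∀ {A} → Closed A → A ≢ ⊤ → ¬ Percolates Π r A
    closed⇒¬percolates {A} A-closed A≢⊤ (k , iterate≡⊤) =
      A≢⊤ (trans (sym (iterate-fixed k)) iterate≡⊤)
      where
      iterate-fixed : ∀ k → iterate Π r k A ≡ A
      iterate-fixed zero    = refl
      iterate-fixed (suc k) = trans (cong (step Π r) (iterate-fixed k)) (closed⇒step≡ A-closed)

    ¬percolates⇒closed-superset : ∀ A → ¬ Percolates Π r A →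
                                  ∃ λ S → A ⊆ S × Closed S × S ≢ ⊤
    ¬percolates⇒closed-superset A ¬perc
      with ⊆-chain-stabilises (λ k → iterate Π r k A) (λ k → p⊆p∪q _)
    ... | k , stable =
      iterate Π r k A , A⊆iterate k , step≡⇒closed stable , λ S≡⊤ → ¬perc (k , S≡⊤)
      where
      A⊆iterate : ∀ k → A ⊆ iterate Π r k A
      A⊆iterate zero    = λ x∈A → x∈A
      A⊆iterate (suc k) = p⊆p∪q _ ∘ A⊆iterate k

    ∣closed∣≤suc-q*[r∸1] : ∀ {S P} → Closed S → P ∉ S → ∣ S ∣ ≤ suc q * (r ∸ 1)
    ∣closed∣≤suc-q*[r∸1] {S} {P} S-closed P∉S = begin
      ∣ S ∣
        ≡⟨ ∣S∣≡∑-over-pencil P∉S ⟩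
      sum (λ l → 𝟙 (on P l) * ∣ line l ∩ S ∣)
        ≤⟨ sum-mono-≤ sparse ⟩
      sum (λ l → 𝟙 (on P l) * (r ∸ 1))
        ≡⟨ sym (*-distribʳ-sum (r ∸ 1) (λ l → 𝟙 (on P l))) ⟩
      sum (λ l → 𝟙 (on P l)) * (r ∸ 1)
        ≡⟨ cong (_* (r ∸ 1)) (∑𝟙[on]≡suc-q P) ⟩
      suc q * (r ∸ 1) ∎
      where
      open ≤-Reasoning
      sparse : ∀ l → 𝟙 (on P l) * ∣ line l ∩ S ∣ ≤ 𝟙 (on P l) * (r ∸ 1)
      sparse l with on P l in P∈l
      ... | false = z≤n
      ... | true  =
        *-monoʳ-≤ 1 (subst (∣ line l ∩ S ∣ ≤_) (pred[m∸n]≡m∸[1+n] r 0) (<⇒≤pred ∣l∩S∣<r))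
        where
        ∣l∩S∣<r : ∣ line l ∩ S ∣ < r
        ∣l∩S∣<r = ≰⇒> (P∉S ∘ S-closed (lookup⇒[]= P (line l) P∈l))

    ⋃-closed : ∀ {L} → ∣ L ∣ < r → Closed (⋃ L)
    ⋃-closed {L} ∣L∣<r {P} {l} P∈l r≤∣l∩⋃L∣ with l ∈? L
    ... | yes l∈L = ∈⋃⁺ l∈L P∈l
    ... | no  l∉L = ⊥-elim (<⇒≱ ∣L∣<r (≤-trans r≤∣l∩⋃L∣ (∣line∩⋃∣≤∣L∣ l∉L)))

  upper-bound : ∀ r → UpperBoundM Π r (suc q * (r ∸ 1))
  upper-bound r A ¬perc with ¬percolates⇒closed-superset r A ¬perc
  ... | S , A⊆S , S-closed , S≢⊤ with p≢⊤⇒∃∉ S≢⊤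
  ...   | P , P∉S = ≤-trans (p⊆q⇒∣p∣≤∣q∣ A⊆S) (∣closed∣≤suc-q*[r∸1] r S-closed P∉S)

  lower-bound : ∀ {r} → 2 ≤ r → r ≤ suc q → LowerBoundM Π r (q * (r ∸ 1) + 1)
  lower-bound {r@(suc (suc k))} (s≤s (s≤s z≤n)) (s≤s k<q)
    with subset-of-size (pencil P₀) (suc k) (subst (suc k ≤_) (sym (point-deg P₀)) (m≤n⇒m≤1+n k<q))
  ... | L , L⊆pencil , ∣L∣≡1+k = ⋃ L , closed⇒¬percolates r ⋃L-closed ⋃L≢⊤ , ⋃L-large
    where
    ⋃L-closed : Closed r (⋃ L)
    ⋃L-closed = ⋃-closed r {L} (≤-reflexive (cong suc ∣L∣≡1+k))
    ⋃L≢⊤ : ⋃ L ≢ ⊤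
    ⋃L≢⊤ = ⋃≢⊤ {L} (≤-trans (≤-reflexive ∣L∣≡1+k) k<q)
    ⋃L-large : q * suc k + 1 ≤ ∣ ⋃ L ∣
    ⋃L-large = subst (λ m → q * m + 1 ≤ ∣ ⋃ L ∣) ∣L∣≡1+k
      (q*∣L∣+1≤∣⋃∣ L⊆pencil (subst (0 <_) (sym ∣L∣≡1+k) z<s))

proposition9 : (q : ℕ) → 2 ≤ q → (Π : ProjectivePlane q) → (r : ℕ) → 3 ≤ r → r ≤ suc q →
    LowerBoundM Π r (q * (r ∸ 1) + 1) × UpperBoundM Π r (suc q * (r ∸ 1))
proposition9 q _ Π r 3≤r r≤suc-q = lower-bound Π (≤-trans (n≤1+n 2) 3≤r) r≤suc-q , upper-bound Π r
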